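{- Let $p$ be any pattern in the symmetry class of one of $(12,\{0,1\},\{0,1\})$, $(12,\{0,1\},\{0,2\})$, $(12,\{0,1\},\{1,2\})$, $(12,\{0,2\},\{0,2\})$. Then for all $n>1$, $a_n(p)=n!-(n-2)!$.
   Context: A bi-vincular pattern of length $k$ is a triple $p=(\sigma,X,Y)$ with $\sigma$ a permutation of $[k]$ in one-line notation and $X,Y\subseteq\{0,1,\dots,k\}$. A permutation $\pi=\pi_1\cdots\pi_n$ of $[n]$ contains $p$ if there are indices $1\le i_1<\dots<i_k\le n$ such that $(\pi_{i_1},\dots,\pi_{i_k})$ is order-isomorphic to $\sigma$ and, writing $j_1<\dots<j_k$ for the set $\{\pi_{i_1},\dots,\pi_{i_k}\}$ in increasing order and setting $i_0=j_0=0$, $i_{k+1}=j_{k+1}=n+1$, we have $i_{x+1}=i_x+1$ for all $x\in X$ and $j_{y+1}=j_y+1$ for all $y\in Y$. Otherwise $\pi$ avoids $p$; $a_n(p)$ is the number of permutations of $[n]$ avoiding $p$. For $p=(\sigma,X,Y)$ of length $k$ define $p^{i}=(\sigma^{ -1},Y,X)$, $p^{r}=(\sigma^{r},\{k-x:x\in X\},Y)$, $p^{c}=(\sigma^{c},X,\{k-y:y\in Y\})$, with $\sigma^r_m=\sigma_{k+1-m}$ and $\sigma^c_m=k+1-\sigma_m$; the symmetry class of $p$ is the set of patterns obtained from $p$ by finite compositions of $i,r,c$. -}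

module Defs where

open import Data.Nat using (ℕ; zero; suc; _+_; _∸_; _<_)
open import Data.Nat.Properties using (≤-decTotalOrder)
open import Data.Fin as F using (Fin; toℕ; opposite)
open import Data.Vec as V using (Vec; lookup)
open import Data.List as L using (List; []; _∷_; _++_; length; allFin)
open import Data.List.Membership.Propositional using (_∈_)
open import Data.List.Relation.Unary.Unique.Propositional using (Unique)
open import Data.List.Sort.InsertionSort ≤-decTotalOrder using (sort)
open import Data.Product using (Σ; _×_; ∃)
open import Relation.Nullary using (¬_)
open import Relation.Binary.PropositionalEquality using (_≡_)
open import Relation.Binary.Construct.Closure.ReflexiveTransitive using (Star)
open import Function.Bundles using (_⇔_)

-- A permutation of [n] in one-line notation, as a vector of 0-based values
-- (value v : Fin n stands for v+1), required to be injective (hence bijective).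
IsPerm : ∀ {n} → Vec (Fin n) n → Set
IsPerm π = ∀ a b → lookup π a ≡ lookup π b → a ≡ b

-- Bi-vincular pattern (σ, X, Y) of length k; σ given 0-based; X, Y finite
-- subsets of ℕ given as lists (only membership matters).
record Pattern : Set where
  constructor pat
  field
    k : ℕ
    σ : Vec (Fin k) k
    X : List ℕ
    Y : List ℕ

nth : List ℕ → ℕ → ℕ
nth [] _ = 0
nth (a ∷ _) zero = a
nth (_ ∷ l) (suc x) = nth l x

-- the extended sequence s_0 = 0, s_1..s_k = l, s_{k+1} = n+1
ext : ℕ → List ℕ → ℕ → ℕ
ext n l x = nth (0 ∷ l ++ (suc n ∷ [])) x

-- Occurrence of p in π: strictly increasing positions ι (0-based),
-- order-isomorphic subsequence, and the adjacency constraints X, Y with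
-- positions i_1<...<i_k and values j_1<...<j_k (1-based).
Occurrence : ∀ {n} → Vec (Fin n) n → (p : Pattern) → (Fin (Pattern.k p) → Fin n) → Set
Occurrence {n} π (pat k σ X Y) ι =
  (∀ a b → a F.< b → ι a F.< ι b) ×
  (∀ a b → (toℕ (lookup σ a) < toℕ (lookup σ b)) ⇔
           (toℕ (lookup π (ι a)) < toℕ (lookup π (ι b)))) ×
  (∀ x → x ∈ X → ext n is (suc x) ≡ suc (ext n is x)) ×
  (∀ y → y ∈ Y → ext n js (suc y) ≡ suc (ext n js y))
  where
  is : List ℕ
  is = L.map (λ a → suc (toℕ (ι a))) (allFin k)
  js : List ℕ
  js = sort (L.map (λ a → suc (toℕ (lookup π (ι a)))) (allFin k))

Contains : ∀ {n} → Vec (Fin n) n → Pattern → Set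
Contains {n} π p = ∃ λ (ι : Fin (Pattern.k p) → Fin n) → Occurrence π p ι

Avoids : ∀ {n} → Vec (Fin n) n → Pattern → Set
Avoids π p = ¬ Contains π p

NumAvoiders : ℕ → Pattern → ℕ → Set
NumAvoiders n p m =
  Σ (List (Vec (Fin n) n)) λ Ls →
    Unique Ls × (∀ π → (π ∈ Ls) ⇔ (IsPerm π × Avoids π p)) × length Ls ≡ m

-- One symmetry step: inverse i, reverse r, complement c; plus re-listing
-- the same sets X, Y (lists are representations of sets).
data Step : Pattern → Pattern → Set where
  inv : ∀ {k} (σ τ : Vec (Fin k) k) X Y →
        (∀ a → lookup τ (lookup σ a) ≡ a) → (∀ a → lookup σ (lookup τ a) ≡ a) →
        Step (pat k σ X Y) (pat k τ Y X)
  rev : ∀ {k} (σ : Vec (Fin k) k) X Y →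
        Step (pat k σ X Y) (pat k (V.reverse σ) (L.map (k ∸_) X) Y)
  com : ∀ {k} (σ : Vec (Fin k) k) X Y →
        Step (pat k σ X Y) (pat k (V.map opposite σ) X (L.map (k ∸_) Y))
  sets : ∀ {k} (σ : Vec (Fin k) k) X Y X′ Y′ →
        (∀ x → (x ∈ X) ⇔ (x ∈ X′)) → (∀ y → (y ∈ Y) ⇔ (y ∈ Y′)) →
        Step (pat k σ X Y) (pat k σ X′ Y′)

InSymClass : Pattern → Pattern → Set
InSymClass p q = Star Step p q

σ12 : Vec (Fin 2) 2
σ12 = F.zero V.∷ F.suc F.zero V.∷ V.[]

p₁ p₂ p₃ p₄ : Pattern
p₁ = pat 2 σ12 (0 ∷ 1 ∷ []) (0 ∷ 1 ∷ [])
p₂ = pat 2 σ12 (0 ∷ 1 ∷ []) (0 ∷ 2 ∷ [])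
p₃ = pat 2 σ12 (0 ∷ 1 ∷ []) (1 ∷ 2 ∷ [])
p₄ = pat 2 σ12 (0 ∷ 2 ∷ []) (0 ∷ 2 ∷ [])

module Submission where

-- Call a length-2 pattern (σ, X, Y) rigid when X and Y are (as sets)
-- 2-subsets of {0,1,2}.  In a permutation of [m+2] the position constraints X
-- then force the two positions of an occurrence and the value constraints Y
-- force its two values, so π contains p iff π carries two prescribed distinct
-- values at two prescribed distinct positions.  Exactly m! permutations do, so
-- (m+2)! − m! avoid p.  Rigidity is preserved by inverse, reverse, complement
-- and re-listing of the sets, and the four generators are rigid.

open import Defs
open import Data.Nat using (ℕ; zero; suc; _+_; _*_; _∸_; _<_; _!; s≤s; z≤n)
open import Data.Nat.Properties using (+-suc; m+n∸m≡n; n<1+n; <-irrefl; <-asym; suc-injective; <⇒≤; ≤⇒≯; ≤-decTotalOrder; _≤?_)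
open import Data.Fin as F using (Fin; toℕ; fromℕ; inject₁; punchIn; punchOut; opposite)
open import Data.Fin.Properties using (_≟_; toℕ-injective; toℕ-fromℕ; toℕ-inject₁; punchIn-injective; punchInᵢ≢i; punchIn-punchOut)
open import Data.Vec as V using (Vec; lookup; tabulate)
open import Data.Vec.Properties using (lookup-map; lookup∘tabulate; insertAt-lookup; insertAt-punchIn)
open import Data.Vec.Relation.Binary.Pointwise.Extensional using (Pointwise-≡⇒≡) renaming (ext to pointwise)
open import Data.List as L using (List; []; _∷_; length; allFin; filter; cartesianProductWith)
open import Data.List.Properties using (length-++; length-map; length-tabulate)
open import Data.List.Membership.Propositional using (_∈_)
open import Data.List.Membership.Propositional.Properties using (∈-map⁺; ∈-map⁻; ∈-filter⁺; ∈-filter⁻; ∈-allFin; ∈-cartesianProductWith⁺; ∈-cartesianProductWith⁻)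
open import Data.List.Membership.Propositional.Properties.WithK using (unique∧set⇒bag)
open import Data.List.Relation.Binary.BagAndSetEquality using (∼bag⇒↭)
open import Data.List.Relation.Binary.Permutation.Propositional.Properties using (↭-length)
open import Data.List.Relation.Unary.Any using (here; there)
open import Data.List.Relation.Unary.All using ([])
open import Data.List.Relation.Unary.AllPairs using ([]; _∷_)
open import Data.List.Relation.Unary.Unique.Propositional using (Unique)
open import Data.List.Relation.Unary.Unique.Propositional.Properties using (map⁺; filter⁺; allFin⁺; cartesianProductWith⁺)
open import Data.List.Sort.InsertionSort ≤-decTotalOrder using (sort)
open import Data.Product using (Σ; _×_; ∃; _,_; proj₁; proj₂)
open import Data.Sum using (_⊎_; inj₁; inj₂)
open import Data.Empty using (⊥-elim)
open import Function using (_∘_)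
open import Level using (0ℓ)
open import Function.Bundles using (_⇔_; mk⇔; Equivalence)
open import Relation.Nullary using (¬_; yes; no)
open import Relation.Nullary.Decidable using (_×-dec_; ¬?; dec-true; dec-false)
open import Relation.Unary using (Pred; Decidable)
open import Relation.Binary.PropositionalEquality
open import Relation.Binary.Construct.Closure.ReflexiveTransitive using (ε; _◅_)

open Equivalence using (to; from)
open ≡-Reasoning

vec-ext : ∀ {A : Set} {n} {xs ys : Vec A n} → (∀ i → lookup xs i ≡ lookup ys i) → xs ≡ ys
vec-ext agree = Pointwise-≡⇒≡ (pointwise agree)

data Around {n} (a : Fin (suc n)) : Fin (suc n) → Set where
  hole    : Around a a
  shifted : (k : Fin n) → Around a (punchIn a k)

around : ∀ {n} (a i : Fin (suc n)) → Around a i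
around a i with a ≟ i
... | yes refl = hole
... | no a≢i   = subst (Around a) (punchIn-punchOut a≢i) (shifted (punchOut a≢i))

plant : ∀ {n} → Fin (suc n) → Fin (suc n) → Vec (Fin n) n → Vec (Fin (suc n)) (suc n)
plant a u ρ = V.insertAt (V.map (punchIn u) ρ) a u

module _ {n} (a u : Fin (suc n)) (ρ : Vec (Fin n) n) where

  plant-hole : lookup (plant a u ρ) a ≡ u
  plant-hole = insertAt-lookup (V.map (punchIn u) ρ) a u

  plant-shifted : ∀ k → lookup (plant a u ρ) (punchIn a k) ≡ punchIn u (lookup ρ k)
  plant-shifted k = trans (insertAt-punchIn (V.map (punchIn u) ρ) a u k) (lookup-map k (punchIn u) ρ)

  plant-isPerm : IsPerm ρ → IsPerm (plant a u ρ)
  plant-isPerm ρ-inj i j eq with around a i | around a j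
  ... | hole      | hole      = refl
  ... | hole      | shifted l = ⊥-elim (punchInᵢ≢i u (lookup ρ l) (trans (sym (plant-shifted l)) (trans (sym eq) plant-hole)))
  ... | shifted k | hole      = ⊥-elim (punchInᵢ≢i u (lookup ρ k) (trans (sym (plant-shifted k)) (trans eq plant-hole)))
  ... | shifted k | shifted l = cong (punchIn a) (ρ-inj k l (punchIn-injective u _ _
                                  (trans (sym (plant-shifted k)) (trans eq (plant-shifted l)))))

plant-injective : ∀ {n} {a u : Fin (suc n)} {ρ τ : Vec (Fin n) n} → plant a u ρ ≡ plant a u τ → ρ ≡ τ
plant-injective {a = a} {u} {ρ} {τ} eq = vec-ext λ k → punchIn-injective u _ _ (begin
  punchIn u (lookup ρ k)             ≡⟨ plant-shifted a u ρ k ⟨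
  lookup (plant a u ρ) (punchIn a k) ≡⟨ cong (λ π → lookup π (punchIn a k)) eq ⟩
  lookup (plant a u τ) (punchIn a k) ≡⟨ plant-shifted a u τ k ⟩
  punchIn u (lookup τ k)             ∎)

unplant : ∀ {n} {a u : Fin (suc n)} {π : Vec (Fin (suc n)) (suc n)} →
  IsPerm π → lookup π a ≡ u → ∃ λ ρ → IsPerm ρ × π ≡ plant a u ρ
unplant {n} {a} {u} {π} π-inj πa≡u = ρ , ρ-inj , vec-ext agree
  where
  misses : ∀ k → u ≢ lookup π (punchIn a k)
  misses k u≡ = punchInᵢ≢i a k (π-inj _ _ (trans (sym u≡) (sym πa≡u)))
  ρ : Vec (Fin n) n
  ρ = tabulate λ k → punchOut (misses k)
  ρ-at : ∀ k → punchIn u (lookup ρ k) ≡ lookup π (punchIn a k)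
  ρ-at k = trans (cong (punchIn u) (lookup∘tabulate _ k)) (punchIn-punchOut (misses k))
  ρ-inj : IsPerm ρ
  ρ-inj k l eq = punchIn-injective a k l (π-inj _ _ (trans (sym (ρ-at k)) (trans (cong (punchIn u) eq) (ρ-at l))))
  agree : ∀ i → lookup π i ≡ lookup (plant a u ρ) i
  agree i with around a i
  ... | hole      = trans πa≡u (sym (plant-hole a u ρ))
  ... | shifted k = trans (sym (ρ-at k)) (sym (plant-shifted a u ρ k))

perms : (n : ℕ) → List (Vec (Fin n) n)
perms zero    = V.[] ∷ []
perms (suc n) = cartesianProductWith (plant F.zero) (allFin (suc n)) (perms n)

length-cartesianProductWith : ∀ {A B C : Set} (f : A → B → C) xs ys →
  length (cartesianProductWith f xs ys) ≡ length xs * length ys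
length-cartesianProductWith f []       ys = refl
length-cartesianProductWith f (x ∷ xs) ys = begin
  length (L.map (f x) ys L.++ cartesianProductWith f xs ys)      ≡⟨ length-++ (L.map (f x) ys) ⟩
  length (L.map (f x) ys) + length (cartesianProductWith f xs ys) ≡⟨ cong₂ _+_ (length-map (f x) ys) (length-cartesianProductWith f xs ys) ⟩
  length ys + length xs * length ys                               ∎

length-perms : ∀ n → length (perms n) ≡ n !
length-perms zero    = refl
length-perms (suc n) = begin
  length (perms (suc n))                     ≡⟨ length-cartesianProductWith (plant F.zero) (allFin (suc n)) (perms n) ⟩
  length (allFin (suc n)) * length (perms n) ≡⟨ cong₂ _*_ (length-tabulate {n = suc n} (λ i → i)) (length-perms n) ⟩
  suc n * n !                                ∎

perms-unique : ∀ n → Unique (perms n)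
perms-unique zero    = [] ∷ []
perms-unique (suc n) = cartesianProductWith⁺ (plant F.zero) plant₀-injective (allFin⁺ (suc n)) (perms-unique n)
  where
  -- the first value is the planted one, so planting at 0 is jointly injective
  plant₀-injective : ∀ {u v ρ τ} → plant F.zero u ρ ≡ plant F.zero v τ → u ≡ v × ρ ≡ τ
  plant₀-injective eq with cong V.head eq
  ... | refl = refl , plant-injective {a = F.zero} eq

perms-sound : ∀ {n} {π : Vec (Fin n) n} → π ∈ perms n → IsPerm π
perms-sound {zero}  {V.[]} _ ()
perms-sound {suc n} π∈ with ∈-cartesianProductWith⁻ (plant F.zero) (allFin (suc n)) (perms n) π∈
... | u , ρ , _ , ρ∈ , refl = plant-isPerm F.zero u ρ (perms-sound ρ∈)

perms-complete : ∀ {n} {π : Vec (Fin n) n} → IsPerm π → π ∈ perms n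
perms-complete {zero}  {V.[]} _ = here refl
perms-complete {suc n} {π} π-inj with unplant {a = F.zero} π-inj refl
... | ρ , ρ-inj , π≡ = subst (_∈ perms (suc n)) (sym π≡)
  (∈-cartesianProductWith⁺ (plant F.zero) (∈-allFin (lookup π F.zero)) (perms-complete ρ-inj))

length-filter-split : ∀ {A : Set} {P : Pred A 0ℓ} (P? : Decidable P) xs →
  length (filter P? xs) + length (filter (¬? ∘ P?) xs) ≡ length xs
length-filter-split P? []       = refl
length-filter-split P? (x ∷ xs) with P? x
... | yes _ = cong suc (length-filter-split P? xs)
... | no  _ = trans (+-suc _ _) (cong suc (length-filter-split P? xs))

same-members⇒same-length : ∀ {A : Set} {xs ys : List A} → Unique xs → Unique ys →
  (∀ {z} → (z ∈ xs) ⇔ (z ∈ ys)) → length xs ≡ length ys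
same-members⇒same-length xs! ys! same = ↭-length (∼bag⇒↭ (unique∧set⇒bag xs! ys! same))

Pinned : ∀ {n} (a b u v : Fin n) → Vec (Fin n) n → Set
Pinned a b u v π = lookup π a ≡ u × lookup π b ≡ v

pinned? : ∀ {n} (a b u v : Fin n) → Decidable (Pinned a b u v)
pinned? a b u v π = (lookup π a ≟ u) ×-dec (lookup π b ≟ v)

-- For a ≠ b and u ≠ v, the permutations of [m+2] pinning u, v at a, b are
-- obtained by planting u at a into the permutations of [m+1] that carry the
-- renumbered value v′ at the renumbered position b′; there are m! of them.
module TwoPinned {m} {a b u v : Fin (suc (suc m))} (a≢b : a ≢ b) (u≢v : u ≢ v) where

  b′ : Fin (suc m)
  b′ = punchOut a≢b

  v′ : Fin (suc m)
  v′ = punchOut u≢v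

  pinnedPerms : List (Vec (Fin (suc (suc m))) (suc (suc m)))
  pinnedPerms = L.map (plant a u ∘ plant b′ v′) (perms m)

  value-at-b : ∀ ρ → lookup (plant a u ρ) b ≡ punchIn u (lookup ρ b′)
  value-at-b ρ = begin
    lookup (plant a u ρ) b              ≡⟨ cong (lookup (plant a u ρ)) (punchIn-punchOut a≢b) ⟨
    lookup (plant a u ρ) (punchIn a b′) ≡⟨ plant-shifted a u ρ b′ ⟩
    punchIn u (lookup ρ b′)             ∎

  carries-v⇔ : ∀ ρ → (lookup (plant a u ρ) b ≡ v) ⇔ (lookup ρ b′ ≡ v′)
  carries-v⇔ ρ = mk⇔
    (λ e → punchIn-injective u _ _ (trans (sym (value-at-b ρ)) (trans e (sym (punchIn-punchOut u≢v)))))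
    (λ e → trans (value-at-b ρ) (trans (cong (punchIn u) e) (punchIn-punchOut u≢v)))

  ∈-pinnedPerms : ∀ {π} → (π ∈ pinnedPerms) ⇔ (IsPerm π × Pinned a b u v π)
  ∈-pinnedPerms = mk⇔ sound complete
    where
    sound : ∀ {π} → π ∈ pinnedPerms → IsPerm π × Pinned a b u v π
    sound π∈ with ∈-map⁻ (plant a u ∘ plant b′ v′) π∈
    ... | τ , τ∈ , refl = plant-isPerm a u (plant b′ v′ τ) (plant-isPerm b′ v′ τ (perms-sound τ∈)) ,
                          plant-hole a u (plant b′ v′ τ) ,
                          from (carries-v⇔ (plant b′ v′ τ)) (plant-hole b′ v′ τ)
    complete : ∀ {π} → IsPerm π × Pinned a b u v π → π ∈ pinnedPerms
    complete {π} (π-inj , πa≡u , πb≡v) with unplant {a = a} {π = π} π-inj πa≡u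
    ... | ρ , ρ-inj , refl with unplant {a = b′} {π = ρ} ρ-inj (to (carries-v⇔ ρ) πb≡v)
    ...   | τ , τ-inj , refl = ∈-map⁺ (plant a u ∘ plant b′ v′) (perms-complete τ-inj)

  pinnedPerms-unique : Unique pinnedPerms
  pinnedPerms-unique = map⁺ (λ eq → plant-injective {a = b′} (plant-injective {a = a} eq)) (perms-unique m)

  count-pinned : length (filter (pinned? a b u v) (perms (suc (suc m)))) ≡ m !
  count-pinned = begin
    length (filter (pinned? a b u v) (perms (suc (suc m)))) ≡⟨ same-members⇒same-length
                                                                 (filter⁺ (pinned? a b u v) (perms-unique _))
                                                                 pinnedPerms-unique in-filter⇔in-pinned ⟩
    length pinnedPerms                                      ≡⟨ length-map (plant a u ∘ plant b′ v′) (perms m) ⟩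
    length (perms m)                                        ≡⟨ length-perms m ⟩
    m !                                                     ∎
    where
    in-filter⇔in-pinned : ∀ {π} → (π ∈ filter (pinned? a b u v) (perms (suc (suc m)))) ⇔ (π ∈ pinnedPerms)
    in-filter⇔in-pinned = mk⇔
      (λ π∈ → let π∈perms , pinned = ∈-filter⁻ (pinned? a b u v) π∈ in
               from ∈-pinnedPerms (perms-sound π∈perms , pinned))
      (λ π∈ → let π-inj , pinned = to ∈-pinnedPerms π∈ in
               ∈-filter⁺ (pinned? a b u v) (perms-complete π-inj) pinned)

omit : Fin 3 → List ℕ
omit F.zero                 = 1 ∷ 2 ∷ []
omit (F.suc F.zero)         = 0 ∷ 2 ∷ []
omit (F.suc (F.suc F.zero)) = 0 ∷ 1 ∷ []

TwoOfThree : List ℕ → Set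
TwoOfThree X = Σ (Fin 3) λ o → ∀ x → (x ∈ X) ⇔ (x ∈ omit o)

Adjacent : ℕ → List ℕ → List ℕ → Set
Adjacent n S l = ∀ x → x ∈ S → ext n l (suc x) ≡ suc (ext n l x)

adjacent-⊆ : ∀ {S S′} n l → (∀ x → x ∈ S → x ∈ S′) → Adjacent n S′ l → Adjacent n S l
adjacent-⊆ n l S⊆S′ adj x x∈S = adj x (S⊆S′ x x∈S)

entries : ∀ {n} → Fin n → Fin n → List ℕ
entries i j = suc (toℕ i) ∷ suc (toℕ j) ∷ []

-- Two entries i < j of [m+2] subject to the adjacency constraints of omit o are
-- forced: omitting 0 forces the last two, omitting 1 the first and the last,
-- omitting 2 the first two.
lower upper : Fin 3 → (m : ℕ) → Fin (suc (suc m))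
lower F.zero                 m = inject₁ (fromℕ m)
lower (F.suc F.zero)         m = F.zero
lower (F.suc (F.suc F.zero)) m = F.zero
upper F.zero                 m = fromℕ (suc m)
upper (F.suc F.zero)         m = fromℕ (suc m)
upper (F.suc (F.suc F.zero)) m = F.suc F.zero

toℕ-penultimate : ∀ m → toℕ (inject₁ (fromℕ m)) ≡ m
toℕ-penultimate m = trans (toℕ-inject₁ (fromℕ m)) (toℕ-fromℕ m)

lower<upper : ∀ o m → toℕ (lower o m) < toℕ (upper o m)
lower<upper F.zero m rewrite toℕ-penultimate m | toℕ-fromℕ m = n<1+n m
lower<upper (F.suc F.zero)         m = s≤s z≤n
lower<upper (F.suc (F.suc F.zero)) m = s≤s z≤n

lower≢upper : ∀ o m → lower o m ≢ upper o m
lower≢upper o m eq = <-irrefl (cong toℕ eq) (lower<upper o m)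

adjacent⇔forced : ∀ m o (i j : Fin (suc (suc m))) →
  Adjacent (suc (suc m)) (omit o) (entries i j) ⇔ (i ≡ lower o m × j ≡ upper o m)
adjacent⇔forced m o i j = mk⇔ (forced o) (λ { (refl , refl) → satisfied o })
  where
  first : suc (toℕ i) ≡ 1 → i ≡ F.zero
  first eq = toℕ-injective (suc-injective eq)
  last : suc (suc (suc m)) ≡ suc (suc (toℕ j)) → j ≡ fromℕ (suc m)
  last eq = toℕ-injective (trans (sym (suc-injective (suc-injective eq))) (sym (toℕ-fromℕ (suc m))))
  next : suc (toℕ j) ≡ suc (suc (toℕ i)) → toℕ j ≡ suc (toℕ i)
  next = suc-injective

  forced : ∀ o → Adjacent (suc (suc m)) (omit o) (entries i j) → i ≡ lower o m × j ≡ upper o m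
  forced F.zero adj with last (adj 2 (there (here refl)))
  ... | refl = toℕ-injective (trans (suc-injective (sym (next (adj 1 (here refl))))) (sym (toℕ-inject₁ (fromℕ m)))) , refl
  forced (F.suc F.zero) adj = first (adj 0 (here refl)) , last (adj 2 (there (here refl)))
  forced (F.suc (F.suc F.zero)) adj with first (adj 0 (here refl))
  ... | refl = refl , toℕ-injective (next (adj 1 (there (here refl))))

  last-sound : suc (suc (suc m)) ≡ suc (suc (toℕ (fromℕ (suc m))))
  last-sound = cong (suc ∘ suc) (sym (toℕ-fromℕ (suc m)))

  satisfied : ∀ o → Adjacent (suc (suc m)) (omit o) (entries (lower o m) (upper o m))
  satisfied F.zero                 _ (here refl)         = cong suc (trans (toℕ-fromℕ (suc m)) (cong suc (sym (toℕ-penultimate m))))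
  satisfied F.zero                 _ (there (here refl)) = last-sound
  satisfied (F.suc F.zero)         _ (here refl)         = refl
  satisfied (F.suc F.zero)         _ (there (here refl)) = last-sound
  satisfied (F.suc (F.suc F.zero)) _ (here refl)         = refl
  satisfied (F.suc (F.suc F.zero)) _ (there (here refl)) = refl

forced-by : ∀ m {X} ((o , _) : TwoOfThree X) (i j : Fin (suc (suc m))) →
  Adjacent (suc (suc m)) X (entries i j) ⇔ (i ≡ lower o m × j ≡ upper o m)
forced-by m (o , X≐) i j = mk⇔
  (to (adjacent⇔forced m o i j) ∘ adjacent-⊆ (suc (suc m)) (entries i j) (λ x → from (X≐ x)))
  (adjacent-⊆ (suc (suc m)) (entries i j) (λ x → to (X≐ x)) ∘ from (adjacent⇔forced m o i j))

data Perm₂ : Vec (Fin 2) 2 → Set where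
  id₂   : Perm₂ σ12
  swap₂ : Perm₂ (F.suc F.zero V.∷ F.zero V.∷ V.[])

lowPos highPos : ∀ {σ} → Perm₂ σ → Fin 2
lowPos id₂    = F.zero
lowPos swap₂  = F.suc F.zero
highPos id₂   = F.suc F.zero
highPos swap₂ = F.zero

order-iso⁺ : ∀ {σ} (s : Perm₂ σ) (f : Fin 2 → ℕ) → f (lowPos s) < f (highPos s) →
  ∀ c d → (toℕ (lookup σ c) < toℕ (lookup σ d)) ⇔ (f c < f d)
order-iso⁺ id₂   f lt F.zero         F.zero         = mk⇔ (λ ()) (λ f0<f0 → ⊥-elim (<-irrefl refl f0<f0))
order-iso⁺ id₂   f lt F.zero         (F.suc F.zero) = mk⇔ (λ _ → lt) (λ _ → s≤s z≤n)
order-iso⁺ id₂   f lt (F.suc F.zero) F.zero         = mk⇔ (λ ()) (λ f1<f0 → ⊥-elim (<-asym lt f1<f0))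
order-iso⁺ id₂   f lt (F.suc F.zero) (F.suc F.zero) = mk⇔ (λ { (s≤s ()) }) (λ f1<f1 → ⊥-elim (<-irrefl refl f1<f1))
order-iso⁺ swap₂ f lt F.zero         F.zero         = mk⇔ (λ { (s≤s ()) }) (λ f0<f0 → ⊥-elim (<-irrefl refl f0<f0))
order-iso⁺ swap₂ f lt F.zero         (F.suc F.zero) = mk⇔ (λ ()) (λ f0<f1 → ⊥-elim (<-asym lt f0<f1))
order-iso⁺ swap₂ f lt (F.suc F.zero) F.zero         = mk⇔ (λ _ → lt) (λ _ → s≤s z≤n)
order-iso⁺ swap₂ f lt (F.suc F.zero) (F.suc F.zero) = mk⇔ (λ ()) (λ f1<f1 → ⊥-elim (<-irrefl refl f1<f1))

order-iso⁻ : ∀ {σ} (s : Perm₂ σ) (f : Fin 2 → ℕ) →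
  (∀ c d → (toℕ (lookup σ c) < toℕ (lookup σ d)) ⇔ (f c < f d)) → f (lowPos s) < f (highPos s)
order-iso⁻ id₂   f iso = to (iso F.zero (F.suc F.zero)) (s≤s z≤n)
order-iso⁻ swap₂ f iso = to (iso (F.suc F.zero) F.zero) (s≤s z≤n)

sort-ordered : ∀ {x y} → x < y → sort (suc x ∷ suc y ∷ []) ≡ suc x ∷ suc y ∷ []
sort-ordered {x} {y} x<y rewrite dec-true (suc x ≤? suc y) (s≤s (<⇒≤ x<y)) = refl

sort-swapped : ∀ {x y} → x < y → sort (suc y ∷ suc x ∷ []) ≡ suc x ∷ suc y ∷ []
sort-swapped {x} {y} x<y rewrite dec-false (suc y ≤? suc x) (λ { (s≤s y≤x) → ≤⇒≯ y≤x x<y }) = refl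

sort-values : ∀ {σ} (s : Perm₂ σ) (f : Fin 2 → ℕ) → f (lowPos s) < f (highPos s) →
  sort (suc (f F.zero) ∷ suc (f (F.suc F.zero)) ∷ []) ≡ suc (f (lowPos s)) ∷ suc (f (highPos s)) ∷ []
sort-values id₂   f lt = sort-ordered lt
sort-values swap₂ f lt = sort-swapped lt

record PinningPattern (m : ℕ) (p : Pattern) : Set where
  field
    a b u v   : Fin (suc (suc m))
    a≢b       : a ≢ b
    u≢v       : u ≢ v
    contains⇔ : ∀ π → Contains π p ⇔ Pinned a b u v π

-- A length-2 pattern whose position and value constraints are both
-- 2-subsets of {0,1,2} is a pinning pattern: the position constraints force
-- the two positions, the value constraints force the two values.
rigid-pinning : ∀ m {σ X Y} → Perm₂ σ → TwoOfThree X → TwoOfThree Y → PinningPattern m (pat 2 σ X Y)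
rigid-pinning m {σ} {X} {Y} s tX@(oX , _) tY@(oY , _) = record
  { a = pos (lowPos s) ; b = pos (highPos s) ; u = lower oY m ; v = upper oY m
  ; a≢b = pos-distinct s ; u≢v = lower≢upper oY m
  ; contains⇔ = λ π → mk⇔ (occurrence⇒pinned π) (pinned⇒occurrence π) }
  where
  N : ℕ
  N = suc (suc m)

  pos : Fin 2 → Fin N
  pos F.zero         = lower oX m
  pos (F.suc F.zero) = upper oX m

  pos-distinct : ∀ s → pos (lowPos s) ≢ pos (highPos s)
  pos-distinct id₂   = lower≢upper oX m
  pos-distinct swap₂ = lower≢upper oX m ∘ sym

  pos-increasing : ∀ c d → c F.< d → pos c F.< pos d
  pos-increasing F.zero         (F.suc F.zero) _ = lower<upper oX m
  pos-increasing F.zero         F.zero         ()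
  pos-increasing (F.suc F.zero) F.zero         ()
  pos-increasing (F.suc F.zero) (F.suc F.zero) (s≤s ())

  -- an occurrence sits at the forced positions and, its values being sorted
  -- with the one at lowPos first, takes the forced values there
  occurrence⇒pinned : ∀ π → Contains π (pat 2 σ X Y) →
    Pinned (pos (lowPos s)) (pos (highPos s)) (lower oY m) (upper oY m) π
  occurrence⇒pinned π (ι , _ , iso , adjX , adjY) =
    subst (λ k → lookup π k ≡ lower oY m) (ι≗pos (lowPos s)) (proj₁ values) ,
    subst (λ k → lookup π k ≡ upper oY m) (ι≗pos (highPos s)) (proj₂ values)
    where
    f : Fin 2 → ℕ
    f c = toℕ (lookup π (ι c))
    positions : ι F.zero ≡ lower oX m × ι (F.suc F.zero) ≡ upper oX m
    positions = to (forced-by m tX (ι F.zero) (ι (F.suc F.zero))) adjX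
    ι≗pos : ∀ c → ι c ≡ pos c
    ι≗pos F.zero         = proj₁ positions
    ι≗pos (F.suc F.zero) = proj₂ positions
    values : lookup π (ι (lowPos s)) ≡ lower oY m × lookup π (ι (highPos s)) ≡ upper oY m
    values = to (forced-by m tY _ _) (subst (Adjacent N Y) (sort-values s f (order-iso⁻ s f iso)) adjY)

  pinned⇒occurrence : ∀ π → Pinned (pos (lowPos s)) (pos (highPos s)) (lower oY m) (upper oY m) π →
    Contains π (pat 2 σ X Y)
  pinned⇒occurrence π (πlow , πhigh) = pos , pos-increasing , order-iso⁺ s f lt , adjX , adjY
    where
    f : Fin 2 → ℕ
    f c = toℕ (lookup π (pos c))
    lt : f (lowPos s) < f (highPos s)
    lt = subst₂ _<_ (cong toℕ (sym πlow)) (cong toℕ (sym πhigh)) (lower<upper oY m)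
    adjX : Adjacent N X (entries (pos F.zero) (pos (F.suc F.zero)))
    adjX = from (forced-by m tX _ _) (refl , refl)
    adjY : Adjacent N Y (sort (entries (lookup π (pos F.zero)) (lookup π (pos (F.suc F.zero)))))
    adjY = subst (Adjacent N Y) (sym (sort-values s f lt)) (from (forced-by m tY _ _) (πlow , πhigh))

-- a_{m+2}(p) = (m+2)! − m! for a pinning pattern: the avoiders are the
-- permutations not pinning u, v at a, b, and exactly m! permutations do.
pinning-avoiders : ∀ {m p} → PinningPattern m p → NumAvoiders (suc (suc m)) p (suc (suc m) ! ∸ m !)
pinning-avoiders {m} {p} P = avoiders , filter⁺ unpinned? (perms-unique N) , ∈-avoiders , length-avoiders
  where
  open PinningPattern P
  N : ℕ
  N = suc (suc m)

  unpinned? : Decidable (λ π → ¬ Pinned a b u v π)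
  unpinned? = ¬? ∘ pinned? a b u v

  pinned avoiders : List (Vec (Fin N) N)
  pinned   = filter (pinned? a b u v) (perms N)
  avoiders = filter unpinned? (perms N)

  ∈-avoiders : ∀ π → (π ∈ avoiders) ⇔ (IsPerm π × Avoids π p)
  ∈-avoiders π = mk⇔
    (λ π∈ → let π∈perms , unpinned = ∈-filter⁻ unpinned? π∈ in
             perms-sound π∈perms , unpinned ∘ to (contains⇔ π))
    (λ (π-inj , avoids) → ∈-filter⁺ unpinned? (perms-complete π-inj) (avoids ∘ from (contains⇔ π)))

  length-avoiders : length avoiders ≡ N ! ∸ m !
  length-avoiders = begin
    length avoiders                                 ≡⟨ m+n∸m≡n (length pinned) (length avoiders) ⟨
    length pinned + length avoiders ∸ length pinned ≡⟨ cong₂ _∸_ (length-filter-split (pinned? a b u v) (perms N))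
                                                                 (TwoPinned.count-pinned a≢b u≢v) ⟩
    length (perms N) ∸ m !                          ≡⟨ cong (_∸ m !) (length-perms N) ⟩
    N ! ∸ m !                                       ∎

data Rigid : Pattern → Set where
  rigid : ∀ {σ X Y} → Perm₂ σ → TwoOfThree X → TwoOfThree Y → Rigid (pat 2 σ X Y)

perm₂-inverse : ∀ {σ τ} → Perm₂ σ → (∀ c → lookup τ (lookup σ c) ≡ c) → Perm₂ τ
perm₂-inverse {τ = x V.∷ y V.∷ V.[]} id₂ τσ≡id with τσ≡id F.zero | τσ≡id (F.suc F.zero)
... | refl | refl = id₂
perm₂-inverse {τ = x V.∷ y V.∷ V.[]} swap₂ τσ≡id with τσ≡id F.zero | τσ≡id (F.suc F.zero)
... | refl | refl = swap₂

perm₂-reverse : ∀ {σ} → Perm₂ σ → Perm₂ (V.reverse σ)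
perm₂-reverse id₂   = swap₂
perm₂-reverse swap₂ = id₂

perm₂-complement : ∀ {σ} → Perm₂ σ → Perm₂ (V.map opposite σ)
perm₂-complement id₂   = swap₂
perm₂-complement swap₂ = id₂

mirror : Fin 3 → Fin 3
mirror F.zero                 = F.suc (F.suc F.zero)
mirror (F.suc F.zero)         = F.suc F.zero
mirror (F.suc (F.suc F.zero)) = F.zero

mirror-omit⁺ : ∀ o y → y ∈ omit o → (2 ∸ y) ∈ omit (mirror o)
mirror-omit⁺ F.zero                 _ (here refl)         = there (here refl)
mirror-omit⁺ F.zero                 _ (there (here refl)) = here refl
mirror-omit⁺ (F.suc F.zero)         _ (here refl)         = there (here refl)
mirror-omit⁺ (F.suc F.zero)         _ (there (here refl)) = here refl
mirror-omit⁺ (F.suc (F.suc F.zero)) _ (here refl)         = there (here refl)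
mirror-omit⁺ (F.suc (F.suc F.zero)) _ (there (here refl)) = here refl

mirror-omit⁻ : ∀ o x → x ∈ omit (mirror o) → ∃ λ y → y ∈ omit o × x ≡ 2 ∸ y
mirror-omit⁻ F.zero                 _ (here refl)         = 2 , there (here refl) , refl
mirror-omit⁻ F.zero                 _ (there (here refl)) = 1 , here refl , refl
mirror-omit⁻ (F.suc F.zero)         _ (here refl)         = 2 , there (here refl) , refl
mirror-omit⁻ (F.suc F.zero)         _ (there (here refl)) = 0 , here refl , refl
mirror-omit⁻ (F.suc (F.suc F.zero)) _ (here refl)         = 1 , there (here refl) , refl
mirror-omit⁻ (F.suc (F.suc F.zero)) _ (there (here refl)) = 0 , here refl , refl

twoOfThree-mirror : ∀ {X} → TwoOfThree X → TwoOfThree (L.map (2 ∸_) X)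
twoOfThree-mirror {X} (o , X≐) = mirror o , λ x → mk⇔ (mirrored x) (unmirrored x)
  where
  mirrored : ∀ x → x ∈ L.map (2 ∸_) X → x ∈ omit (mirror o)
  mirrored x x∈ with ∈-map⁻ (2 ∸_) x∈
  ... | y , y∈X , refl = mirror-omit⁺ o y (to (X≐ y) y∈X)
  unmirrored : ∀ x → x ∈ omit (mirror o) → x ∈ L.map (2 ∸_) X
  unmirrored x x∈ with mirror-omit⁻ o x x∈
  ... | y , y∈omit , refl = ∈-map⁺ (2 ∸_) (from (X≐ y) y∈omit)

twoOfThree-resp : ∀ {X X′} → (∀ x → (x ∈ X) ⇔ (x ∈ X′)) → TwoOfThree X → TwoOfThree X′
twoOfThree-resp X≐X′ (o , X≐) = o , λ x → mk⇔ (to (X≐ x) ∘ from (X≐X′ x)) (to (X≐X′ x) ∘ from (X≐ x))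

rigid-step : ∀ {p q} → Step p q → Rigid p → Rigid q
rigid-step (inv σ τ X Y τσ≡id _)    (rigid s tX tY) = rigid (perm₂-inverse s τσ≡id) tY tX
rigid-step (rev σ X Y)              (rigid s tX tY) = rigid (perm₂-reverse s) (twoOfThree-mirror tX) tY
rigid-step (com σ X Y)              (rigid s tX tY) = rigid (perm₂-complement s) tX (twoOfThree-mirror tY)
rigid-step (sets σ X Y X′ Y′ eX eY) (rigid s tX tY) = rigid s (twoOfThree-resp eX tX) (twoOfThree-resp eY tY)

rigid-class : ∀ {p q} → InSymClass p q → Rigid p → Rigid q
rigid-class ε          r = r
rigid-class (st ◅ sts) r = rigid-class sts (rigid-step st r)

rigid-12 : ∀ oX oY → Rigid (pat 2 σ12 (omit oX) (omit oY))
rigid-12 oX oY = rigid id₂ (oX , same) (oY , same)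
  where
  same : ∀ {S} x → (x ∈ S) ⇔ (x ∈ S)
  same x = mk⇔ (λ x∈ → x∈) (λ x∈ → x∈)

rigid-generators : ∀ {p} → InSymClass p₁ p ⊎ InSymClass p₂ p ⊎ InSymClass p₃ p ⊎ InSymClass p₄ p → Rigid p
rigid-generators (inj₁ c)               = rigid-class c (rigid-12 (F.suc (F.suc F.zero)) (F.suc (F.suc F.zero)))
rigid-generators (inj₂ (inj₁ c))        = rigid-class c (rigid-12 (F.suc (F.suc F.zero)) (F.suc F.zero))
rigid-generators (inj₂ (inj₂ (inj₁ c))) = rigid-class c (rigid-12 (F.suc (F.suc F.zero)) F.zero)
rigid-generators (inj₂ (inj₂ (inj₂ c))) = rigid-class c (rigid-12 (F.suc F.zero) (F.suc F.zero))

mainTheorem5 : (p : Pattern) →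
    (InSymClass p₁ p ⊎ InSymClass p₂ p ⊎ InSymClass p₃ p ⊎ InSymClass p₄ p) →
    (n : ℕ) → 1 < n → NumAvoiders n p (n ! ∸ (n ∸ 2) !)
mainTheorem5 p inClass (suc zero)    (s≤s ())
mainTheorem5 p inClass (suc (suc m)) _ with rigid-generators inClass
... | rigid s tX tY = pinning-avoiders (rigid-pinning m s tX tY)
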